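{- For all integers $n,\ell\ge1$, let $p(n,\ell)=\operatorname{lcm}\big\{\ell!/(i_1!\cdots i_n!):(i_1,\dots,i_n)\in\mathbf N^n,\ i_1+\dots+i_n=\ell\big\}$. Then $$p(n,\ell)=\prod_{j=1}^{n-1}\frac{\operatorname{lcm}\big(1,2,3,\dots,\lfloor(\ell+n-1)/j\rfloor\big)}{\ell+j}.$$
   Context: $\lfloor\cdot\rfloor$ denotes the integer part; the empty product (for $n=1$) equals $1$. -}

module Defs where

open import Data.Nat using (ℕ; zero; suc; _+_; _*_; _∸_; _!; NonZero)
open import Data.Nat.Properties using (_!≢0; m*n≢0)
import Data.Nat.DivMod
open Data.Nat.DivMod using (_/_)
open import Data.Nat.LCM using (lcm)
open import Data.Vec using (Vec; []; _∷_)
open import Data.List using (List; []; _∷_; map; concatMap; upTo; foldr)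
open import Data.Integer using (+_)
import Data.Rational as ℚ
open ℚ using (ℚ)

compositions : (n ℓ : ℕ) → List (Vec ℕ n)
compositions zero zero = [] ∷ []
compositions zero (suc ℓ) = []
compositions (suc n) ℓ =
  concatMap (λ i → map (i ∷_) (compositions n (ℓ ∸ i))) (upTo (suc ℓ))

factProd : ∀ {n} → Vec ℕ n → ℕ
factProd [] = 1
factProd (i ∷ is) = i ! * factProd is

factProd≢0 : ∀ {n} (v : Vec ℕ n) → NonZero (factProd v)
factProd≢0 [] = _
factProd≢0 (i ∷ is) = m*n≢0 (i !) (factProd is) {{i !≢0}} {{factProd≢0 is}}

-- multinomial coefficient ℓ! / (i₁! ⋯ iₙ!)  (exact division)
multinomial : ∀ {n} (ℓ : ℕ) → Vec ℕ n → ℕ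
multinomial ℓ v = Data.Nat.DivMod._/_ (ℓ !) (factProd v) {{factProd≢0 v}}

lcmList : List ℕ → ℕ
lcmList = foldr lcm 1

p : ℕ → ℕ → ℕ
p n ℓ = lcmList (map (multinomial ℓ) (compositions n ℓ))

lcmUpTo : ℕ → ℕ
lcmUpTo m = lcmList (map suc (upTo m))

prodℚ : ℕ → (ℕ → ℚ) → ℚ
prodℚ zero f = ℚ.1ℚ
prodℚ (suc k) f = prodℚ k f ℚ.* f (suc k)

-- the j-th factor  lcm(1,…,⌊(ℓ+n-1)/j⌋) / (ℓ+j), for j ≥ 1
-- (j is passed as suc j', so ℓ + suc j' is visibly nonzero after +-suc)
factor : ℕ → ℕ → ℕ → ℚ
factor n ℓ j' = ℚ._/_ (+ lcmUpTo ((ℓ + n ∸ 1) / suc j')) (suc (ℓ + j'))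

rhs : ℕ → ℕ → ℚ
rhs n ℓ = prodℚ (n ∸ 1) (λ j → factor n ℓ (j ∸ 1))

-- Compare q-adic valuations for every prime q.  By Legendre's formula,
-- v_q(ℓ!/(i₁!⋯iₙ!)) = Σ_k (⌊ℓ/q^k⌋ − Σ_t ⌊i_t/q^k⌋), and since
-- ⌊(x+y+1)/d⌋ ≤ ⌊x/d⌋ + ⌊y/d⌋ + 1, every inner sum is at least
-- ⌊(ℓ+n−1)/q^k⌋ − (n−1).  A greedy composition, whose parts are of the form q^a − 1
-- except the last, attains this bound for all k at once, so v_q(p(n,ℓ)) is
-- Σ_k (⌊ℓ/q^k⌋ − max(0, ⌊(ℓ+n−1)/q^k⌋ − (n−1))).  On the other side,
-- v_q(lcm(1,…,m)) counts the k ≥ 1 with q^k ≤ m, so exchanging the order of summation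
-- turns the valuation of the product of numerators into Σ_k min(n−1, ⌊(ℓ+n−1)/q^k⌋),
-- while the product of denominators is (ℓ+n−1)!/ℓ!.  The two sides agree because
-- min(r, x) + max(0, x − r) = x.
module Submission where

open import Data.Nat hiding (_/_)
open import Data.Nat.Properties
open import Data.Nat.Divisibility
open import Data.Nat.DivMod using (m/n*n≡m)
open import Data.Nat.Primality
  using (Prime; prime⇒nonZero; prime⇒nonTrivial; euclidsLemma; productOfPrimes≢0)
open import Data.Nat.Primality.Factorisation using (factorise)
open import Data.Nat.GCD using (gcd; gcd-greatest)
open import Data.Nat.LCM using (lcm; gcd*lcm; lcm-comm; m∣lcm[m,n]; n∣lcm[m,n])
open import Data.Nat.Combinatorics using (k![n∸k]!∣n!)
open import Data.Nat.ListAction using (product)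
open import Data.Nat.Tactic.RingSolver using (solve-∀)
open import Data.Product using (∃; _×_; _,_; proj₁; proj₂)
open import Data.Sum using (inj₁; inj₂)
open import Data.Empty using (⊥-elim)
open import Data.Vec using (Vec; []; _∷_; sum; map)
open import Data.List using ([]; _∷_; upTo)
import Data.List as List
open import Data.List.Relation.Unary.All using (All; []; _∷_)
import Data.List.Relation.Unary.All as All
open import Data.List.Relation.Unary.All.Properties using (map⁺)
open import Data.List.Relation.Unary.Any using (here; there)
open import Data.List.Membership.Propositional using (_∈_) renaming (find to find-∈; lose to lose-∈)
open import Data.List.Membership.Propositional.Properties
  using (∈-map⁺; ∈-map⁻; ∈-concatMap⁺; ∈-concatMap⁻; ∈-upTo⁺; ∈-upTo⁻)
open import Relation.Nullary using (¬_; Dec; yes; no)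
open import Relation.Binary.Definitions using (tri<; tri≈; tri>)
open import Relation.Binary.PropositionalEquality
open import Defs using (compositions; factProd; factProd≢0; multinomial; lcmList; lcmUpTo; p)

𝟙 : ∀ {a} {P : Set a} → Dec P → ℕ
𝟙 (yes _) = 1
𝟙 (no _)  = 0

𝟙-cong : ∀ {a b} {P : Set a} {Q : Set b} (P? : Dec P) (Q? : Dec Q) →
         (P → Q) → (Q → P) → 𝟙 P? ≡ 𝟙 Q?
𝟙-cong (yes _)  (yes _)  _ _ = refl
𝟙-cong (no _)   (no _)   _ _ = refl
𝟙-cong (yes x)  (no ¬y)  f _ = ⊥-elim (¬y (f x))
𝟙-cong (no ¬x)  (yes y)  _ g = ⊥-elim (¬x (g y))

∑ : ℕ → (ℕ → ℕ) → ℕ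
∑ zero    f = 0
∑ (suc K) f = ∑ K f + f (suc K)

∏ : ℕ → (ℕ → ℕ) → ℕ
∏ zero    f = 1
∏ (suc K) f = ∏ K f * f (suc K)

∏≢0 : ∀ K f → (∀ k → NonZero (f k)) → NonZero (∏ K f)
∏≢0 zero    f f≢0 = _
∏≢0 (suc K) f f≢0 = m*n≢0 (∏ K f) (f (suc K)) {{∏≢0 K f f≢0}} {{f≢0 (suc K)}}

∑-cong : ∀ K {f g} → (∀ {k} → 1 ≤ k → k ≤ K → f k ≡ g k) → ∑ K f ≡ ∑ K g
∑-cong zero    f≡g = refl
∑-cong (suc K) f≡g =
  cong₂ _+_ (∑-cong K λ 1≤k k≤K → f≡g 1≤k (m≤n⇒m≤1+n k≤K)) (f≡g (s≤s z≤n) ≤-refl)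

∑-mono-≤ : ∀ K {f g} → (∀ {k} → 1 ≤ k → k ≤ K → f k ≤ g k) → ∑ K f ≤ ∑ K g
∑-mono-≤ zero    f≤g = z≤n
∑-mono-≤ (suc K) f≤g =
  +-mono-≤ (∑-mono-≤ K λ 1≤k k≤K → f≤g 1≤k (m≤n⇒m≤1+n k≤K)) (f≤g (s≤s z≤n) ≤-refl)

∑-zero : ∀ K → ∑ K (λ _ → 0) ≡ 0
∑-zero zero    = refl
∑-zero (suc K) = trans (+-identityʳ _) (∑-zero K)

∑-distrib-+ : ∀ K f g → ∑ K (λ k → f k + g k) ≡ ∑ K f + ∑ K g
∑-distrib-+ zero    f g = refl
∑-distrib-+ (suc K) f g = begin
  ∑ K (λ k → f k + g k) + (F + G) ≡⟨ cong (_+ (F + G)) (∑-distrib-+ K f g) ⟩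
  ∑ K f + ∑ K g + (F + G)         ≡⟨ interchange (∑ K f) (∑ K g) F G ⟩
  ∑ K f + F + (∑ K g + G)         ∎
  where
  open ≡-Reasoning
  F = f (suc K)
  G = g (suc K)
  interchange : ∀ a b c d → a + b + (c + d) ≡ a + c + (b + d)
  interchange = solve-∀

∑-comm : ∀ J K (f : ℕ → ℕ → ℕ) → ∑ J (λ j → ∑ K (f j)) ≡ ∑ K (λ k → ∑ J (λ j → f j k))
∑-comm zero    K f = sym (∑-zero K)
∑-comm (suc J) K f = trans (cong (_+ ∑ K (f (suc J))) (∑-comm J K f))
                           (sym (∑-distrib-+ K (λ k → ∑ J (λ j → f j k)) (f (suc J))))

∑-𝟙-≤ : ∀ K c → ∑ K (λ k → 𝟙 (k ≤? c)) ≡ K ⊓ c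
∑-𝟙-≤ zero    c = refl
∑-𝟙-≤ (suc K) c with suc K ≤? c
... | yes 1+K≤c = begin
  ∑ K (λ k → 𝟙 (k ≤? c)) + 1 ≡⟨ cong (_+ 1) (∑-𝟙-≤ K c) ⟩
  K ⊓ c + 1                  ≡⟨ cong (_+ 1) (m≤n⇒m⊓n≡m (≤-trans (n≤1+n K) 1+K≤c)) ⟩
  K + 1                      ≡⟨ +-comm K 1 ⟩
  suc K                      ≡⟨ m≤n⇒m⊓n≡m 1+K≤c ⟨
  suc K ⊓ c                  ∎
  where open ≡-Reasoning
... | no  1+K≰c = begin
  ∑ K (λ k → 𝟙 (k ≤? c)) + 0 ≡⟨ +-identityʳ _ ⟩
  ∑ K (λ k → 𝟙 (k ≤? c))     ≡⟨ ∑-𝟙-≤ K c ⟩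
  K ⊓ c                      ≡⟨ m≥n⇒m⊓n≡n c≤K ⟩
  c                          ≡⟨ m≥n⇒m⊓n≡n (m≤n⇒m≤1+n c≤K) ⟨
  suc K ⊓ c                  ∎
  where
  open ≡-Reasoning
  c≤K : c ≤ K
  c≤K = s≤s⁻¹ (≰⇒> 1+K≰c)

module Floor where
  open import Data.Nat.DivMod
    using ( _/_; m/n*n≤m; m≡m%n+[m/n]*n; m%n<n; m*n/n≡m; m<n*o⇒m/o<n; /-monoˡ-≤
          ; +-distrib-/-∣ʳ; m<n⇒m/n≡0)

  m<[1+m/n]*n : ∀ m n .{{_ : NonZero n}} → m < suc (m / n) * n
  m<[1+m/n]*n m n = begin-strict
    m                   ≡⟨ m≡m%n+[m/n]*n m n ⟩
    m % n + m / n * n   <⟨ +-monoˡ-< (m / n * n) (m%n<n m n) ⟩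
    n + m / n * n       ∎
    where open ≤-Reasoning

  /-unique : ∀ {m n k} .{{_ : NonZero n}} → k * n ≤ m → m < suc k * n → m / n ≡ k
  /-unique {m} {n} {k} lo hi with <-cmp (m / n) k
  ... | tri≈ _ m/n≡k _ = m/n≡k
  ... | tri< m/n<k _ _ = ⊥-elim (<⇒≱ (m<[1+m/n]*n m n) (≤-trans (*-monoˡ-≤ n m/n<k) lo))
  ... | tri> _ _ k<m/n = ⊥-elim (<⇒≱ hi (≤-trans (*-monoˡ-≤ n k<m/n) (m/n*n≤m m n)))

  ≤/⇒*≤ : ∀ {k m n} .{{_ : NonZero n}} → k ≤ m / n → k * n ≤ m
  ≤/⇒*≤ {k} {m} {n} k≤m/n = ≤-trans (*-monoˡ-≤ n k≤m/n) (m/n*n≤m m n)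

  *≤⇒≤/ : ∀ {k m n} .{{_ : NonZero n}} → k * n ≤ m → k ≤ m / n
  *≤⇒≤/ {k} {m} {n} k*n≤m = subst (_≤ m / n) (m*n/n≡m k n) (/-monoˡ-≤ n k*n≤m)

  ≤/-comm : ∀ {k m n} .{{_ : NonZero k}} .{{_ : NonZero n}} → k ≤ m / n → n ≤ m / k
  ≤/-comm {k} {m} {n} k≤m/n = *≤⇒≤/ (subst (_≤ m) (*-comm k n) (≤/⇒*≤ k≤m/n))

  [m+k*n]/n : ∀ m k n .{{_ : NonZero n}} → (m + k * n) / n ≡ m / n + k
  [m+k*n]/n m k n = trans (+-distrib-/-∣ʳ m (n∣m*n k)) (cong (m / n +_) (m*n/n≡m k n))

  [1+m]/n : ∀ m n .{{_ : NonZero n}} → suc m / n ≡ m / n + 𝟙 (n ∣? suc m)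
  [1+m]/n m n with n ∣? suc m
  ... | no n∤1+m = trans (/-unique (m≤n⇒m≤1+n (m/n*n≤m m n)) 1+m<[1+m/n]*n) (sym (+-identityʳ _))
    where
    1+m<[1+m/n]*n : suc m < suc (m / n) * n
    1+m<[1+m/n]*n with m≤n⇒m<n∨m≡n (m<[1+m/n]*n m n)
    ... | inj₁ 1+m< = 1+m<
    ... | inj₂ 1+m≡ = ⊥-elim (n∤1+m (divides (suc (m / n)) 1+m≡))
  ... | yes (divides zero 1+m≡0) = ⊥-elim (1+n≢0 1+m≡0)
  ... | yes (divides (suc c) 1+m≡[1+c]*n) = begin
    suc m / n   ≡⟨ cong (_/ n) 1+m≡[1+c]*n ⟩
    suc c * n / n ≡⟨ m*n/n≡m (suc c) n ⟩
    suc c       ≡⟨ +-comm 1 c ⟩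
    c + 1       ≡⟨ cong (_+ 1) (/-unique c*n≤m (≤-reflexive 1+m≡[1+c]*n)) ⟨
    m / n + 1   ∎
    where
    open ≡-Reasoning
    c*n≤m : c * n ≤ m
    c*n≤m = s≤s⁻¹ (≤-trans (+-monoˡ-≤ (c * n) (>-nonZero⁻¹ n)) (≤-reflexive (sym 1+m≡[1+c]*n)))

  [m+n+1]/o≤m/o+n/o+1 : ∀ m n o .{{_ : NonZero o}} → (m + n + 1) / o ≤ m / o + n / o + 1
  [m+n+1]/o≤m/o+n/o+1 m n o = s≤s⁻¹ (m<n*o⇒m/o<n (begin
    suc (m + n + 1)                    ≡⟨ regroup m n ⟩
    suc m + suc n                      ≤⟨ +-mono-≤ (m<[1+m/n]*n m o) (m<[1+m/n]*n n o) ⟩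
    suc (m / o) * o + suc (n / o) * o  ≡⟨ *-distribʳ-+ o (suc (m / o)) (suc (n / o)) ⟨
    (suc (m / o) + suc (n / o)) * o    ≡⟨ cong (_* o) (regroup (m / o) (n / o)) ⟨
    suc (m / o + n / o + 1) * o        ∎))
    where
    open ≤-Reasoning
    regroup : ∀ a b → suc (a + b + 1) ≡ suc a + suc b
    regroup = solve-∀

  sum-/-lower : ∀ d .{{_ : NonZero d}} r (i : Vec ℕ (suc r)) →
                (sum i + r) / d ≤ sum (map (_/ d) i) + r
  sum-/-lower d zero    (t ∷ []) = ≤-reflexive (begin-equality
    (t + 0 + 0) / d    ≡⟨ cong (_/ d) (trans (+-identityʳ (t + 0)) (+-identityʳ t)) ⟩
    t / d              ≡⟨ trans (+-identityʳ (t / d + 0)) (+-identityʳ (t / d)) ⟨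
    t / d + 0 + 0      ∎)
    where open ≤-Reasoning
  sum-/-lower d (suc r) (t ∷ i) = begin
    (t + sum i + suc r) / d                ≡⟨ cong (_/ d) (regroup t (sum i) r) ⟩
    (t + (sum i + r) + 1) / d              ≤⟨ [m+n+1]/o≤m/o+n/o+1 t (sum i + r) d ⟩
    t / d + (sum i + r) / d + 1            ≤⟨ +-monoˡ-≤ 1 (+-monoʳ-≤ (t / d) (sum-/-lower d r i)) ⟩
    t / d + (sum (map (_/ d) i) + r) + 1   ≡⟨ regroup (t / d) (sum (map (_/ d) i)) r ⟨
    t / d + sum (map (_/ d) i) + suc r     ∎
    where
    open ≤-Reasoning
    regroup : ∀ a b c → a + b + suc c ≡ a + (b + c) + 1
    regroup = solve-∀

  balanced-step-∣ : ∀ {d w u r} .{{_ : NonZero d}} → suc r * suc u ≤ w + suc u → d ∣ suc u →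
                    u / d + (w / d ∸ r) ≡ (w + suc u) / d ∸ suc r
  balanced-step-∣ {d} {w} {u} {r} _     (divides zero ())
  balanced-step-∣ {d} {w} {u} {r} bound (divides (suc c) 1+u≡[1+c]*d) = begin-equality
    u / d + (w / d ∸ r)       ≡⟨ cong (_+ (w / d ∸ r)) (/-unique c*d≤u (≤-reflexive 1+u≡[1+c]*d)) ⟩
    c + (w / d ∸ r)           ≡⟨ +-comm c (w / d ∸ r) ⟩
    w / d ∸ r + c             ≡⟨ +-∸-comm c r≤w/d ⟨
    w / d + c ∸ r             ≡⟨ cong (_∸ suc r) (+-suc (w / d) c) ⟨
    w / d + suc c ∸ suc r     ≡⟨ cong (_∸ suc r) [w+1+u]/d ⟨
    (w + suc u) / d ∸ suc r   ∎
    where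
    open ≤-Reasoning
    c*d≤u : c * d ≤ u
    c*d≤u = s≤s⁻¹ (≤-trans (+-monoˡ-≤ (c * d) (>-nonZero⁻¹ d)) (≤-reflexive (sym 1+u≡[1+c]*d)))
    [w+1+u]/d : (w + suc u) / d ≡ w / d + suc c
    [w+1+u]/d = trans (cong (λ x → (w + x) / d) 1+u≡[1+c]*d) ([m+k*n]/n w (suc c) d)
    [1+r]*[1+c]*d≤w+1+u : suc r * suc c * d ≤ w + suc u
    [1+r]*[1+c]*d≤w+1+u = subst (_≤ w + suc u)
      (trans (cong (suc r *_) 1+u≡[1+c]*d) (sym (*-assoc (suc r) (suc c) d))) bound
    r≤w/d : r ≤ w / d
    r≤w/d = +-cancelʳ-≤ (suc c) r (w / d) (begin
      r + suc c               ≤⟨ +-monoˡ-≤ (suc c) (m≤m*n r (suc c)) ⟩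
      r * suc c + suc c       ≡⟨ +-comm (r * suc c) (suc c) ⟩
      suc r * suc c           ≤⟨ *≤⇒≤/ [1+r]*[1+c]*d≤w+1+u ⟩
      (w + suc u) / d         ≡⟨ [w+1+u]/d ⟩
      w / d + suc c           ∎)

  balanced-step-< : ∀ {d w u r} .{{_ : NonZero d}} → suc u ≤ d → w + suc u < suc r * d →
                    u / d + (w / d ∸ r) ≡ (w + suc u) / d ∸ suc r
  balanced-step-< {d} {w} {u} {r} 1+u≤d w+1+u<[1+r]*d = begin
    u / d + (w / d ∸ r)       ≡⟨ cong₂ _+_ (m<n⇒m/n≡0 1+u≤d) (m≤n⇒m∸n≡0 w/d≤r) ⟩
    0                         ≡⟨ m≤n⇒m∸n≡0 [w+1+u]/d≤1+r ⟨
    (w + suc u) / d ∸ suc r   ∎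
    where
    open ≡-Reasoning
    [w+1+u]/d≤1+r : (w + suc u) / d ≤ suc r
    [w+1+u]/d≤1+r = <⇒≤ (m<n*o⇒m/o<n w+1+u<[1+r]*d)
    w/d≤r : w / d ≤ r
    w/d≤r = s≤s⁻¹ (m<n*o⇒m/o<n (≤-<-trans (m≤m+n w (suc u)) w+1+u<[1+r]*d))

^-monoʳ-∣ : ∀ m {k l} → k ≤ l → m ^ k ∣ m ^ l
^-monoʳ-∣ m {k} {l} k≤l = divides (m ^ (l ∸ k))
  (trans (cong (m ^_) (sym (m∸n+n≡m k≤l))) (^-distribˡ-+-* m (l ∸ k) k))

≡-nonZero : ∀ {m n} → m ≡ n → .{{NonZero m}} → NonZero n
≡-nonZero {m} m≡n = ≢-nonZero λ n≡0 → ≢-nonZero⁻¹ m (trans m≡n n≡0)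

gcd*lcm≢0 : ∀ m n .{{_ : NonZero m}} .{{_ : NonZero n}} → NonZero (gcd m n * lcm m n)
gcd*lcm≢0 m n = ≡-nonZero (sym (gcd*lcm m n)) {{m*n≢0 m n}}

gcd≢0 : ∀ m n .{{_ : NonZero m}} .{{_ : NonZero n}} → NonZero (gcd m n)
gcd≢0 m n = m*n≢0⇒m≢0 (gcd m n) {{gcd*lcm≢0 m n}}

lcm≢0 : ∀ m n .{{_ : NonZero m}} .{{_ : NonZero n}} → NonZero (lcm m n)
lcm≢0 m n = m*n≢0⇒n≢0 (gcd m n) {{gcd*lcm≢0 m n}}

lcmList≢0 : ∀ {xs} → All NonZero xs → NonZero (lcmList xs)
lcmList≢0 []                   = _
lcmList≢0 {x ∷ xs} (x≢0 ∷ xs≢0) = lcm≢0 x (lcmList xs) {{x≢0}} {{lcmList≢0 xs≢0}}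

∈⇒∣lcmList : ∀ {x xs} → x ∈ xs → x ∣ lcmList xs
∈⇒∣lcmList {xs = y ∷ xs} (here refl) = m∣lcm[m,n] y (lcmList xs)
∈⇒∣lcmList {xs = y ∷ xs} (there x∈) = ∣-trans (∈⇒∣lcmList x∈) (n∣lcm[m,n] y (lcmList xs))

module Valuation (q : ℕ) (q-prime : Prime q) where
  open import Data.Nat.DivMod using (_/_; m*[n/m]≡n; m/n<m)

  instance
    q≢0 : NonZero q
    q≢0 = prime⇒nonZero q-prime

  1<q : 1 < q
  1<q = nonTrivial⇒n>1 q {{prime⇒nonTrivial q-prime}}

  private
    ν : ℕ → ℕ → ℕ
    ν zero       a = 0
    ν (suc fuel) a with q ∣? a
    ... | yes _ = suc (ν fuel (a / q))
    ... | no  _ = 0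

    ν-exact : ∀ fuel a .{{_ : NonZero a}} → a ≤ fuel →
              q ^ ν fuel a ∣ a × ¬ q ^ suc (ν fuel a) ∣ a
    ν-exact zero       (suc _) ()
    ν-exact (suc fuel) a a≤1+fuel with q ∣? a
    ... | no q∤a = 1∣ a , λ q*1∣a → q∤a (subst (_∣ a) (*-identityʳ q) q*1∣a)
    ... | yes q∣a =
      subst (q * q ^ e ∣_) q*[a/q]≡a (*-monoʳ-∣ q (proj₁ IH)) ,
      λ q*q*q^e∣a → proj₂ IH (*-cancelˡ-∣ q (subst (q * (q * q ^ e) ∣_) (sym q*[a/q]≡a) q*q*q^e∣a))
      where
      q*[a/q]≡a : q * (a / q) ≡ a
      q*[a/q]≡a = m*[n/m]≡n q∣a
      instance
        _ = m*n≢0⇒n≢0 q {{≡-nonZero (sym q*[a/q]≡a)}}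
      e = ν fuel (a / q)
      IH = ν-exact fuel (a / q) (s≤s⁻¹ (≤-trans (m/n<m a q 1<q) a≤1+fuel))

  v : ℕ → ℕ
  v a = ν a a

  q^v∣ : ∀ a .{{_ : NonZero a}} → q ^ v a ∣ a
  q^v∣ a = proj₁ (ν-exact a a ≤-refl)

  q^[1+v]∤ : ∀ a .{{_ : NonZero a}} → ¬ q ^ suc (v a) ∣ a
  q^[1+v]∤ a = proj₂ (ν-exact a a ≤-refl)

  ≤v⇒q^∣ : ∀ a {k} .{{_ : NonZero a}} → k ≤ v a → q ^ k ∣ a
  ≤v⇒q^∣ a k≤v = ∣-trans (^-monoʳ-∣ q k≤v) (q^v∣ a)

  q^∣⇒≤v : ∀ a {k} .{{_ : NonZero a}} → q ^ k ∣ a → k ≤ v a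
  q^∣⇒≤v a {k} q^k∣a = ≮⇒≥ λ v<k → q^[1+v]∤ a (∣-trans (^-monoʳ-∣ q v<k) q^k∣a)

  v<id : ∀ a .{{_ : NonZero a}} → v a < a
  v<id a = <-≤-trans (n<q^n (v a)) (∣⇒≤ (q^v∣ a))
    where
    n<q^n : ∀ k → k < q ^ k
    n<q^n zero    = s≤s z≤n
    n<q^n (suc k) = <-≤-trans (s≤s (n<q^n k))
      (subst (q ^ k <_) (*-comm (q ^ k) q) (m<m*n (q ^ k) q {{m^n≢0 q k}} 1<q))

  v[r*q^e]≡e : ∀ r e .{{_ : NonZero r}} → ¬ q ∣ r → v (r * q ^ e) ≡ e
  v[r*q^e]≡e r e q∤r = ≤-antisym v≤e (q^∣⇒≤v (r * q ^ e) (n∣m*n r))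
    where
    instance
      _ = m^n≢0 q e
      _ = m*n≢0 r (q ^ e)
    v≤e : v (r * q ^ e) ≤ e
    v≤e = ≮⇒≥ λ e<v → q∤r (*-cancelʳ-∣ (q ^ e) (≤v⇒q^∣ (r * q ^ e) e<v))

  q-free-part : ∀ a .{{_ : NonZero a}} → ∃ λ r → a ≡ r * q ^ v a × ¬ q ∣ r
  q-free-part a with q^v∣ a
  ... | divides r a≡r*q^v = r , a≡r*q^v , λ q∣r →
    q^[1+v]∤ a (subst (q * q ^ v a ∣_) (sym a≡r*q^v) (*-monoˡ-∣ (q ^ v a) q∣r))

  v-* : ∀ a b .{{_ : NonZero a}} .{{_ : NonZero b}} → v (a * b) ≡ v a + v b
  v-* a b with q-free-part a | q-free-part b
  ... | r , a≡r*q^ , q∤r | s , b≡s*q^ , q∤s = begin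
    v (a * b)                     ≡⟨ cong v a*b≡ ⟩
    v (r * s * q ^ (v a + v b))   ≡⟨ v[r*q^e]≡e (r * s) (v a + v b) q∤r*s ⟩
    v a + v b                     ∎
    where
    open ≡-Reasoning
    a*b≡ : a * b ≡ r * s * q ^ (v a + v b)
    a*b≡ = begin
      a * b                         ≡⟨ cong₂ _*_ a≡r*q^ b≡s*q^ ⟩
      r * q ^ v a * (s * q ^ v b)   ≡⟨ interchange r (q ^ v a) s (q ^ v b) ⟩
      r * s * (q ^ v a * q ^ v b)   ≡⟨ cong (r * s *_) (^-distribˡ-+-* q (v a) (v b)) ⟨
      r * s * q ^ (v a + v b)       ∎
      where
      interchange : ∀ w x y z → w * x * (y * z) ≡ w * y * (x * z)
      interchange = solve-∀
    instance
      _ = m*n≢0 r s {{m*n≢0⇒m≢0 r {{≡-nonZero a≡r*q^}}}} {{m*n≢0⇒m≢0 s {{≡-nonZero b≡s*q^}}}}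
    q∤r*s : ¬ q ∣ r * s
    q∤r*s q∣r*s with euclidsLemma r s q-prime q∣r*s
    ... | inj₁ q∣r = q∤r q∣r
    ... | inj₂ q∣s = q∤s q∣s

  v[1]≡0 : v 1 ≡ 0
  v[1]≡0 = n<1⇒n≡0 (v<id 1)

  v[q]≡1 : v q ≡ 1
  v[q]≡1 = trans (cong v (sym 1*q^1≡q)) (v[r*q^e]≡e 1 1 λ q∣1 → <⇒≢ 1<q (sym (∣1⇒≡1 q∣1)))
    where
    1*q^1≡q : 1 * q ^ 1 ≡ q
    1*q^1≡q = trans (*-identityˡ (q ^ 1)) (*-identityʳ q)

  v-mono-∣ : ∀ a b .{{_ : NonZero a}} .{{_ : NonZero b}} → a ∣ b → v a ≤ v b
  v-mono-∣ a b a∣b = q^∣⇒≤v b (∣-trans (q^v∣ a) a∣b)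

  v-∏ : ∀ K f → (f≢0 : ∀ k → NonZero (f k)) → v (∏ K f) ≡ ∑ K (λ k → v (f k))
  v-∏ zero    f f≢0 = v[1]≡0
  v-∏ (suc K) f f≢0 = trans (v-* (∏ K f) (f (suc K)) {{∏≢0 K f f≢0}} {{f≢0 (suc K)}})
                            (cong (_+ v (f (suc K))) (v-∏ K f f≢0))

  v≡∑𝟙 : ∀ a K .{{_ : NonZero a}} → v a ≤ K → v a ≡ ∑ K (λ k → 𝟙 (q ^ k ∣? a))
  v≡∑𝟙 a K v≤K = sym (begin
    ∑ K (λ k → 𝟙 (q ^ k ∣? a))  ≡⟨ ∑-cong K (λ {k} _ _ → 𝟙-cong (q ^ k ∣? a) (k ≤? v a) q^∣⇒≤ ≤⇒q^∣) ⟩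
    ∑ K (λ k → 𝟙 (k ≤? v a))    ≡⟨ ∑-𝟙-≤ K (v a) ⟩
    K ⊓ v a                     ≡⟨ m≥n⇒m⊓n≡n v≤K ⟩
    v a                         ∎)
    where
    open ≡-Reasoning
    q^∣⇒≤ = q^∣⇒≤v a
    ≤⇒q^∣ = ≤v⇒q^∣ a

  v[lcm]≤v-right : ∀ a b .{{_ : NonZero a}} .{{_ : NonZero b}} → v a ≤ v b → v (lcm a b) ≤ v b
  v[lcm]≤v-right a b va≤vb = +-cancelˡ-≤ (v a) (v (lcm a b)) (v b) (begin
    v a + v (lcm a b)           ≤⟨ +-monoˡ-≤ (v (lcm a b)) va≤v[gcd] ⟩
    v (gcd a b) + v (lcm a b)   ≡⟨ v-* (gcd a b) (lcm a b) ⟨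
    v (gcd a b * lcm a b)       ≡⟨ cong v (gcd*lcm a b) ⟩
    v (a * b)                   ≡⟨ v-* a b ⟩
    v a + v b                   ∎)
    where
    open ≤-Reasoning
    instance
      _ = gcd≢0 a b
      _ = lcm≢0 a b
    va≤v[gcd] : v a ≤ v (gcd a b)
    va≤v[gcd] = q^∣⇒≤v (gcd a b) (gcd-greatest (q^v∣ a) (≤v⇒q^∣ b va≤vb))

  v[lcm]-lub : ∀ a b {e} .{{_ : NonZero a}} .{{_ : NonZero b}} →
               v a ≤ e → v b ≤ e → v (lcm a b) ≤ e
  v[lcm]-lub a b va≤e vb≤e with ≤-total (v a) (v b)
  ... | inj₁ va≤vb = ≤-trans (v[lcm]≤v-right a b va≤vb) vb≤e
  ... | inj₂ vb≤va = subst (_≤ _) (cong v (lcm-comm b a)) (≤-trans (v[lcm]≤v-right b a vb≤va) va≤e)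

  v[lcmList]-lub : ∀ {xs e} → All NonZero xs → All (λ x → v x ≤ e) xs → v (lcmList xs) ≤ e
  v[lcmList]-lub []          []            = subst (_≤ _) (sym v[1]≡0) z≤n
  v[lcmList]-lub {x ∷ xs} (x≢0 ∷ xs≢0) (vx≤e ∷ vxs≤e) =
    v[lcm]-lub x (lcmList xs) {{x≢0}} {{lcmList≢0 xs≢0}} vx≤e (v[lcmList]-lub xs≢0 vxs≤e)

product-∣ : ∀ {ps} b .{{_ : NonZero b}} → All Prime ps →
            (∀ q (q-prime : Prime q) → Valuation.v q q-prime (product ps) ≤ Valuation.v q q-prime b) →
            product ps ∣ b
product-∣ b [] _ = 1∣ b
product-∣ {q ∷ ps} b (q-prime ∷ ps-prime) v≤v with q∣b
  where
  module Vq = Valuation q q-prime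
  instance _ = productOfPrimes≢0 ps-prime
  v[q*P]≡1+v[P] : Vq.v (q * product ps) ≡ 1 + Vq.v (product ps)
  v[q*P]≡1+v[P] = trans (Vq.v-* q (product ps)) (cong (_+ Vq.v (product ps)) Vq.v[q]≡1)
  1≤v[q*P] : 1 ≤ Vq.v (q * product ps)
  1≤v[q*P] = subst (1 ≤_) (sym v[q*P]≡1+v[P]) (s≤s z≤n)
  q∣b : q ∣ b
  q∣b = subst (_∣ b) (*-identityʳ q) (Vq.≤v⇒q^∣ b (≤-trans 1≤v[q*P] (v≤v q q-prime)))
... | divides c b≡c*q = subst (q * P ∣_) (trans (*-comm q c) (sym b≡c*q)) (*-monoʳ-∣ q P∣c)
  where
  P = product ps
  instance
    _ = productOfPrimes≢0 ps-prime
    _ = m*n≢0⇒m≢0 c {{≡-nonZero b≡c*q}}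
    _ = prime⇒nonZero q-prime
  P∣c : P ∣ c
  P∣c = product-∣ c ps-prime λ r r-prime → let open Valuation r r-prime in
    +-cancelˡ-≤ (v q) (v P) (v c) (begin
      v q + v P  ≡⟨ v-* q P ⟨
      v (q * P)  ≤⟨ v≤v r r-prime ⟩
      v b        ≡⟨ cong v b≡c*q ⟩
      v (c * q)  ≡⟨ v-* c q ⟩
      v c + v q  ≡⟨ +-comm (v c) (v q) ⟩
      v q + v c  ∎)
    where open ≤-Reasoning

∣-by-valuations : ∀ a b .{{_ : NonZero a}} .{{_ : NonZero b}} →
                  (∀ q (q-prime : Prime q) → Valuation.v q q-prime a ≤ Valuation.v q q-prime b) →
                  a ∣ b
∣-by-valuations a b v≤v with factorise a
... | record { factors = ps ; isFactorisation = a≡∏ps ; factorsPrime = ps-prime } =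
  subst (_∣ b) (sym a≡∏ps) (product-∣ b ps-prime λ q q-prime →
    subst (λ x → Valuation.v q q-prime x ≤ _) a≡∏ps (v≤v q q-prime))

≡-by-valuations : ∀ a b .{{_ : NonZero a}} .{{_ : NonZero b}} →
                  (∀ q (q-prime : Prime q) → Valuation.v q q-prime a ≡ Valuation.v q q-prime b) →
                  a ≡ b
≡-by-valuations a b v≡v = ∣-antisym
  (∣-by-valuations a b λ q q-prime → ≤-reflexive (v≡v q q-prime))
  (∣-by-valuations b a λ q q-prime → ≤-reflexive (sym (v≡v q q-prime)))

∈-compositions⁻ : ∀ n ℓ {i : Vec ℕ n} → i ∈ compositions n ℓ → sum i ≡ ℓ
∈-compositions⁻ zero    zero (here refl) = refl
∈-compositions⁻ (suc n) ℓ    i∈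
  with t , t∈ , i∈′ ← find-∈ (∈-concatMap⁻ (λ t → List.map (t ∷_) (compositions n (ℓ ∸ t)))
                                           {xs = upTo (suc ℓ)} i∈)
  with i′ , i′∈ , refl ← ∈-map⁻ (t ∷_) i∈′
  = trans (cong (t +_) (∈-compositions⁻ n (ℓ ∸ t) i′∈)) (m+[n∸m]≡n (s≤s⁻¹ (∈-upTo⁻ t∈)))

∈-compositions⁺ : ∀ n ℓ (i : Vec ℕ n) → sum i ≡ ℓ → i ∈ compositions n ℓ
∈-compositions⁺ zero    .0 []       refl = here refl
∈-compositions⁺ (suc n) ℓ  (t ∷ i′) Σi≡ℓ =
  ∈-concatMap⁺ (λ t → List.map (t ∷_) (compositions n (ℓ ∸ t)))
    (lose-∈ (∈-upTo⁺ (s≤s t≤ℓ)) (∈-map⁺ (t ∷_) (∈-compositions⁺ n (ℓ ∸ t) i′ Σi′≡ℓ∸t)))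
  where
  t≤ℓ : t ≤ ℓ
  t≤ℓ = subst (t ≤_) Σi≡ℓ (m≤m+n t (sum i′))
  Σi′≡ℓ∸t : sum i′ ≡ ℓ ∸ t
  Σi′≡ℓ∸t = trans (sym (m+n∸m≡n t (sum i′))) (cong (_∸ t) Σi≡ℓ)

factProd∣sum! : ∀ {n} (i : Vec ℕ n) → factProd i ∣ sum i !
factProd∣sum! []      = ∣-refl
factProd∣sum! (t ∷ i) = ∣-trans (*-monoʳ-∣ (t !) (factProd∣sum! i))
  (subst (λ s → t ! * s ! ∣ (t + sum i) !) (m+n∸m≡n t (sum i)) (k![n∸k]!∣n! (m≤m+n t (sum i))))

multinomial*factProd : ∀ {n} ℓ (i : Vec ℕ n) → sum i ≡ ℓ → multinomial ℓ i * factProd i ≡ ℓ !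
multinomial*factProd ℓ i refl = m/n*n≡m {{factProd≢0 i}} (factProd∣sum! i)

multinomial≢0 : ∀ {n} ℓ (i : Vec ℕ n) → sum i ≡ ℓ → NonZero (multinomial ℓ i)
multinomial≢0 ℓ i Σi≡ℓ =
  m*n≢0⇒m≢0 (multinomial ℓ i) {{≡-nonZero (sym (multinomial*factProd ℓ i Σi≡ℓ)) {{ℓ !≢0}}}}

multinomials≢0 : ∀ n ℓ → All NonZero (List.map (multinomial ℓ) (compositions n ℓ))
multinomials≢0 n ℓ = map⁺ (All.tabulate λ {i} i∈ → multinomial≢0 ℓ i (∈-compositions⁻ n ℓ i∈))

p≢0 : ∀ n ℓ → NonZero (p n ℓ)
p≢0 n ℓ = lcmList≢0 (multinomials≢0 n ℓ)

∏[ℓ+j]*ℓ!≡[ℓ+r]! : ∀ r ℓ → ∏ r (λ j → suc (ℓ + (j ∸ 1))) * ℓ ! ≡ (ℓ + r) !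
∏[ℓ+j]*ℓ!≡[ℓ+r]! zero    ℓ = trans (*-identityˡ (ℓ !)) (cong _! (sym (+-identityʳ ℓ)))
∏[ℓ+j]*ℓ!≡[ℓ+r]! (suc r) ℓ = begin
  ∏ r D * suc (ℓ + r) * ℓ !    ≡⟨ *-right-comm (∏ r D) (suc (ℓ + r)) (ℓ !) ⟩
  suc (ℓ + r) * (∏ r D * ℓ !)  ≡⟨ cong (suc (ℓ + r) *_) (∏[ℓ+j]*ℓ!≡[ℓ+r]! r ℓ) ⟩
  suc (ℓ + r) * (ℓ + r) !      ≡⟨ cong _! (+-suc ℓ r) ⟨
  (ℓ + suc r) !                ∎
  where
  open ≡-Reasoning
  D : ℕ → ℕ
  D j = suc (ℓ + (j ∸ 1))
  *-right-comm : ∀ a b c → a * b * c ≡ b * (a * c)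
  *-right-comm = solve-∀

∀-upTo-suc : ∀ {P : ℕ → Set} m → (∀ x → x < m → P (suc x)) → All P (List.map suc (upTo m))
∀-upTo-suc m P[1+x] = map⁺ (All.tabulate λ x∈ → P[1+x] _ (∈-upTo⁻ x∈))

lcmUpTo≢0 : ∀ m → NonZero (lcmUpTo m)
lcmUpTo≢0 m = lcmList≢0 (∀-upTo-suc m λ _ _ → _)

module Legendre (q : ℕ) (q-prime : Prime q) where
  open import Data.Nat.DivMod using (_/_; 0/n≡0; m/n≤m)
  open Valuation q q-prime
  open Floor

  infixl 7 _/q^_
  _/q^_ : ℕ → ℕ → ℕ
  x /q^ k = (x / q ^ k) {{m^n≢0 q k}}

  ∑0/q^≡0 : ∀ K → ∑ K (λ k → 0 /q^ k) ≡ 0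
  ∑0/q^≡0 K = trans (∑-cong K λ {k} _ _ → 0/n≡0 (q ^ k) {{m^n≢0 q k}}) (∑-zero K)

  legendre : ∀ x K → x ≤ K → v (x !) ≡ ∑ K (λ k → x /q^ k)
  legendre zero    K _ = trans v[1]≡0 (sym (∑0/q^≡0 K))
  legendre (suc x) K 1+x≤K = begin
    v (suc x * x !)                                         ≡⟨ v-* (suc x) (x !) {{_}} {{x !≢0}} ⟩
    v (suc x) + v (x !)                                     ≡⟨ cong₂ _+_ v[1+x] (legendre x K x≤K) ⟩
    ∑ K (λ k → 𝟙 (q ^ k ∣? suc x)) + ∑ K (λ k → x /q^ k)    ≡⟨ ∑-distrib-+ K _ _ ⟨
    ∑ K (λ k → 𝟙 (q ^ k ∣? suc x) + x /q^ k)                ≡⟨ ∑-cong K (λ {k} _ _ → floor-step k) ⟩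
    ∑ K (λ k → suc x /q^ k)                                 ∎
    where
    open ≡-Reasoning
    x≤K = ≤-trans (n≤1+n x) 1+x≤K
    v[1+x] : v (suc x) ≡ ∑ K (λ k → 𝟙 (q ^ k ∣? suc x))
    v[1+x] = v≡∑𝟙 (suc x) K (<⇒≤ (<-≤-trans (v<id (suc x)) 1+x≤K))
    floor-step : ∀ k → 𝟙 (q ^ k ∣? suc x) + x /q^ k ≡ suc x /q^ k
    floor-step k = trans (+-comm (𝟙 (q ^ k ∣? suc x)) (x /q^ k)) (sym ([1+m]/n x (q ^ k) {{m^n≢0 q k}}))

  v-factProd : ∀ {n} (i : Vec ℕ n) K → sum i ≤ K →
               v (factProd i) ≡ ∑ K (λ k → sum (map (_/q^ k) i))
  v-factProd []      K _   = trans v[1]≡0 (sym (∑-zero K))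
  v-factProd (t ∷ i) K Σ≤K = begin
    v (t ! * factProd i)                                    ≡⟨ v-* (t !) (factProd i) ⟩
    v (t !) + v (factProd i)                                ≡⟨ cong₂ _+_ (legendre t K t≤K) (v-factProd i K Σi≤K) ⟩
    ∑ K (λ k → t /q^ k) + ∑ K (λ k → sum (map (_/q^ k) i))  ≡⟨ ∑-distrib-+ K _ _ ⟨
    ∑ K (λ k → t /q^ k + sum (map (_/q^ k) i))              ∎
    where
    open ≡-Reasoning
    instance
      _ = t !≢0
      _ = factProd≢0 i
    t≤K = ≤-trans (m≤m+n t (sum i)) Σ≤K
    Σi≤K = ≤-trans (m≤n+m (sum i) t) Σ≤K

  v-multinomial : ∀ {n} ℓ (i : Vec ℕ n) K → sum i ≡ ℓ → ℓ ≤ K →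
                  v (multinomial ℓ i) + ∑ K (λ k → sum (map (_/q^ k) i)) ≡ ∑ K (λ k → ℓ /q^ k)
  v-multinomial ℓ i K Σi≡ℓ ℓ≤K = begin
    v M + ∑ K (λ k → sum (map (_/q^ k) i))  ≡⟨ cong (v M +_) (v-factProd i K Σi≤K) ⟨
    v M + v (factProd i)                    ≡⟨ v-* M (factProd i) ⟨
    v (M * factProd i)                      ≡⟨ cong v (multinomial*factProd ℓ i Σi≡ℓ) ⟩
    v (ℓ !)                                 ≡⟨ legendre ℓ K ℓ≤K ⟩
    ∑ K (λ k → ℓ /q^ k)                     ∎
    where
    open ≡-Reasoning
    M = multinomial ℓ i
    Σi≤K = subst (_≤ K) (sym Σi≡ℓ) ℓ≤K
    instance
      _ = multinomial≢0 ℓ i Σi≡ℓ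
      _ = factProd≢0 i

  q^∣lcmUpTo⇒≤ : ∀ m {k} → 1 ≤ k → q ^ k ∣ lcmUpTo m → q ^ k ≤ m
  q^∣lcmUpTo⇒≤ m {suc k} _ q^k∣L = ≮⇒≥ λ m<q^k → <-irrefl refl (≤-trans k<v[L] (v[L]≤k m<q^k))
    where
    instance _ = lcmUpTo≢0 m
    k<v[L] : k < v (lcmUpTo m)
    k<v[L] = q^∣⇒≤v (lcmUpTo m) q^k∣L
    v[L]≤k : m < q ^ suc k → v (lcmUpTo m) ≤ k
    v[L]≤k m<q^k = v[lcmList]-lub (∀-upTo-suc m λ _ _ → _) (∀-upTo-suc m λ x x<m →
      ≮⇒≥ λ k<v → <⇒≱ m<q^k (≤-trans (∣⇒≤ (≤v⇒q^∣ (suc x) k<v)) x<m))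

  ≤⇒q^∣lcmUpTo : ∀ m {k} → q ^ k ≤ m → q ^ k ∣ lcmUpTo m
  ≤⇒q^∣lcmUpTo m {k} q^k≤m = subst (_∣ lcmUpTo m) 1+pred[q^k]≡q^k
    (∈⇒∣lcmList (∈-map⁺ suc (∈-upTo⁺ (subst (_≤ m) (sym 1+pred[q^k]≡q^k) q^k≤m))))
    where
    1+pred[q^k]≡q^k : suc (pred (q ^ k)) ≡ q ^ k
    1+pred[q^k]≡q^k = suc-pred (q ^ k) {{m^n≢0 q k}}

  v-lcmUpTo : ∀ m K → m ≤ K → v (lcmUpTo m) ≡ ∑ K (λ k → 𝟙 (q ^ k ≤? m))
  v-lcmUpTo m K m≤K = trans (v≡∑𝟙 (lcmUpTo m) K v[L]≤K) (∑-cong K λ {k} 1≤k _ →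
    𝟙-cong (q ^ k ∣? lcmUpTo m) (q ^ k ≤? m) (q^∣lcmUpTo⇒≤ m 1≤k) (≤⇒q^∣lcmUpTo m {k}))
    where
    instance _ = lcmUpTo≢0 m
    v[L]≤K : v (lcmUpTo m) ≤ K
    v[L]≤K = ≤-trans (v[lcmList]-lub (∀-upTo-suc m λ _ _ → _)
                                     (∀-upTo-suc m λ x x<m → <⇒≤ (<-≤-trans (v<id (suc x)) x<m)))
                     m≤K

  v-∏lcmUpTo : ∀ r M K → M ≤ K →
               v (∏ r (λ j → lcmUpTo (M / suc (j ∸ 1)))) ≡ ∑ K (λ k → r ⊓ (M /q^ k))
  v-∏lcmUpTo r M K M≤K = begin
    v (∏ r (λ j → lcmUpTo (M/ j)))             ≡⟨ v-∏ r _ (λ j → lcmUpTo≢0 (M/ j)) ⟩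
    ∑ r (λ j → v (lcmUpTo (M/ j)))             ≡⟨ ∑-cong r (λ {j} _ _ → v-lcmUpTo (M/ j) K (M/j≤K j)) ⟩
    ∑ r (λ j → ∑ K (λ k → 𝟙 (q ^ k ≤? M/ j)))  ≡⟨ ∑-comm r K _ ⟩
    ∑ K (λ k → ∑ r (λ j → 𝟙 (q ^ k ≤? M/ j)))  ≡⟨ ∑-cong K (λ {k} _ _ → ∑-cong r (count-swap k)) ⟩
    ∑ K (λ k → ∑ r (λ j → 𝟙 (j ≤? M /q^ k)))   ≡⟨ ∑-cong K (λ {k} _ _ → ∑-𝟙-≤ r (M /q^ k)) ⟩
    ∑ K (λ k → r ⊓ (M /q^ k))                  ∎
    where
    open ≡-Reasoning
    M/_ : ℕ → ℕ
    M/ j = M / suc (j ∸ 1)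
    M/j≤K : ∀ j → M/ j ≤ K
    M/j≤K j = ≤-trans (m/n≤m M (suc (j ∸ 1))) M≤K
    count-swap : ∀ k {j} → 1 ≤ j → j ≤ r → 𝟙 (q ^ k ≤? M/ j) ≡ 𝟙 (j ≤? M /q^ k)
    count-swap k {suc j} _ _ = 𝟙-cong (q ^ k ≤? M / suc j) (suc j ≤? M /q^ k)
      (≤/-comm {{m^n≢0 q k}}) (≤/-comm {{_}} {{m^n≢0 q k}})

power-bracket : ∀ b → 1 < b → ∀ X → 1 ≤ X → ∃ λ a → b ^ a ≤ X × X < b ^ suc a
power-bracket b 1<b (suc zero)    _ = 0 , ≤-refl , subst (1 <_) (sym (*-identityʳ b)) 1<b
power-bracket b 1<b (suc (suc X)) _ with power-bracket b 1<b (suc X) (s≤s z≤n)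
... | a , b^a≤1+X , 1+X<b^[1+a] with b ^ suc a ≤? suc (suc X)
...   | yes b^[1+a]≤2+X =
  suc a , b^[1+a]≤2+X , ≤-<-trans 1+X<b^[1+a] (^-monoʳ-< b 1<b (n<1+n (suc a)))
...   | no  b^[1+a]≰2+X = a , m≤n⇒m≤1+n b^a≤1+X , ≰⇒> b^[1+a]≰2+X

-- In balanced (suc r) ℓ the first part is q^a − 1 for the largest a with (r + 1) q^a ≤ ℓ + r + 1:
-- for k ≤ a, q^k divides it plus one, and for k > a it is below q^k and ℓ + r + 1 < (r + 1) q^k,
-- so each step of sum-/-lower is tight (balanced-step-∣, balanced-step-<).
module BalancedComposition (q : ℕ) (q-prime : Prime q) where
  open import Data.Nat.DivMod using (_/_; m≥n⇒m/n>0)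
  open Valuation q q-prime using (1<q; q≢0)
  open Legendre q q-prime using (_/q^_)
  open Floor

  private
    bracket : ∀ r ℓ → ∃ λ a → q ^ a ≤ (ℓ + suc r) / suc r × (ℓ + suc r) / suc r < q ^ suc a
    bracket r ℓ = power-bracket q 1<q _ (m≥n⇒m/n>0 (m≤n+m (suc r) ℓ))

    exponent : ℕ → ℕ → ℕ
    exponent r ℓ = proj₁ (bracket r ℓ)

  part : ℕ → ℕ → ℕ
  part r ℓ = pred (q ^ exponent r ℓ)

  1+part≡q^exponent : ∀ r ℓ → suc (part r ℓ) ≡ q ^ exponent r ℓ
  1+part≡q^exponent r ℓ = suc-pred (q ^ exponent r ℓ) {{m^n≢0 q (exponent r ℓ)}}

  part-lower : ∀ r ℓ → suc r * suc (part r ℓ) ≤ ℓ + suc r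
  part-lower r ℓ =
    subst (_≤ ℓ + suc r) q^a*[1+r]≡[1+r]*[1+part] (≤/⇒*≤ (proj₁ (proj₂ (bracket r ℓ))))
    where
    q^a*[1+r]≡[1+r]*[1+part] : q ^ exponent r ℓ * suc r ≡ suc r * suc (part r ℓ)
    q^a*[1+r]≡[1+r]*[1+part] =
      trans (*-comm (q ^ exponent r ℓ) (suc r)) (cong (suc r *_) (sym (1+part≡q^exponent r ℓ)))

  part-upper : ∀ r ℓ → ℓ + suc r < suc r * q ^ suc (exponent r ℓ)
  part-upper r ℓ = ≰⇒> λ [1+r]*q^[1+a]≤ℓ+1+r → <⇒≱ (proj₂ (proj₂ (bracket r ℓ)))
    (*≤⇒≤/ (subst (_≤ ℓ + suc r) (*-comm (suc r) _) [1+r]*q^[1+a]≤ℓ+1+r))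

  part≤ : ∀ r ℓ → part r ℓ ≤ ℓ
  part≤ r ℓ = +-cancelʳ-≤ (suc r) u ℓ (begin
    u + suc r          ≡⟨ +-suc u r ⟩
    suc u + r          ≤⟨ +-monoʳ-≤ (suc u) (m≤m*n r (suc u)) ⟩
    suc u + r * suc u  ≤⟨ part-lower r ℓ ⟩
    ℓ + suc r          ∎)
    where
    open ≤-Reasoning
    u = part r ℓ

  balanced : ∀ r → ℕ → Vec ℕ (suc r)
  balanced zero    ℓ = ℓ ∷ []
  balanced (suc r) ℓ = part r ℓ ∷ balanced r (ℓ ∸ part r ℓ)

  sum-balanced : ∀ r ℓ → sum (balanced r ℓ) ≡ ℓ
  sum-balanced zero    ℓ = +-identityʳ ℓ
  sum-balanced (suc r) ℓ =
    trans (cong (part r ℓ +_) (sum-balanced r (ℓ ∸ part r ℓ))) (m+[n∸m]≡n (part≤ r ℓ))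

  sum-/q^-balanced : ∀ r ℓ k → sum (map (_/q^ k) (balanced r ℓ)) ≡ (ℓ + r) /q^ k ∸ r
  sum-/q^-balanced zero    ℓ k = trans (+-identityʳ (ℓ /q^ k)) (cong (_/q^ k) (sym (+-identityʳ ℓ)))
  sum-/q^-balanced (suc r) ℓ k = begin
    u /q^ k + sum (map (_/q^ k) (balanced r (ℓ ∸ u)))  ≡⟨ cong (u /q^ k +_) (sum-/q^-balanced r (ℓ ∸ u) k) ⟩
    u /q^ k + (w /q^ k ∸ r)                            ≡⟨ step (k ≤? a) ⟩
    (w + suc u) /q^ k ∸ suc r                          ≡⟨ cong (λ x → x /q^ k ∸ suc r) w+1+u≡ℓ+1+r ⟩
    (ℓ + suc r) /q^ k ∸ suc r                          ∎
    where
    open ≡-Reasoning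
    instance _ = m^n≢0 q k
    a = exponent r ℓ
    u = part r ℓ
    w = ℓ ∸ u + r
    w+1+u≡ℓ+1+r : w + suc u ≡ ℓ + suc r
    w+1+u≡ℓ+1+r = trans (regroup (ℓ ∸ u) r u) (cong (_+ suc r) (m∸n+n≡m (part≤ r ℓ)))
      where
      regroup : ∀ x y z → x + y + suc z ≡ x + z + suc y
      regroup = solve-∀
    bound : suc r * suc u ≤ w + suc u
    bound = subst (suc r * suc u ≤_) (sym w+1+u≡ℓ+1+r) (part-lower r ℓ)
    step : Dec (k ≤ a) → u /q^ k + (w /q^ k ∸ r) ≡ (w + suc u) /q^ k ∸ suc r
    step (yes k≤a) =
      balanced-step-∣ bound (subst (q ^ k ∣_) (sym (1+part≡q^exponent r ℓ)) (^-monoʳ-∣ q k≤a))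
    step (no  k≰a) = balanced-step-<
      (subst (_≤ q ^ k) (sym (1+part≡q^exponent r ℓ)) (^-monoʳ-≤ q (<⇒≤ a<k)))
      (subst (_< suc r * q ^ k) (sym w+1+u≡ℓ+1+r)
        (<-≤-trans (part-upper r ℓ) (*-monoʳ-≤ (suc r) (^-monoʳ-≤ q a<k))))
      where
      a<k = ≰⇒> k≰a

module ValuationIdentity (q : ℕ) (q-prime : Prime q) where
  open import Data.Nat.DivMod using (_/_)
  open Valuation q q-prime
  open Legendre q q-prime
  open BalancedComposition q q-prime
  open Floor using (sum-/-lower)

  v-p : ∀ r ℓ K → ℓ ≤ K →
        v (p (suc r) ℓ) + ∑ K (λ k → (ℓ + r) /q^ k ∸ r) ≡ ∑ K (λ k → ℓ /q^ k)
  v-p r ℓ K ℓ≤K = begin-equality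
    v (lcmList ms) + S*   ≡⟨ cong (_+ S*) (≤-antisym v[p]≤v[M*] v[M*]≤v[p]) ⟩
    v M* + S*             ≡⟨ cong (v M* +_) S[i*]≡S* ⟨
    v M* + S i*           ≡⟨ v-multinomial ℓ i* K (sum-balanced r ℓ) ℓ≤K ⟩
    ∑ K (λ k → ℓ /q^ k)   ∎
    where
    open ≤-Reasoning
    ms = List.map (multinomial ℓ) (compositions (suc r) ℓ)
    i* = balanced r ℓ
    M* = multinomial ℓ i*
    instance
      _ = multinomial≢0 ℓ i* (sum-balanced r ℓ)
      _ = p≢0 (suc r) ℓ
    S : Vec ℕ (suc r) → ℕ
    S i = ∑ K (λ k → sum (map (_/q^ k) i))
    S* = ∑ K (λ k → (ℓ + r) /q^ k ∸ r)
    S[i*]≡S* : S i* ≡ S*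
    S[i*]≡S* = ∑-cong K λ {k} _ _ → sum-/q^-balanced r ℓ k
    S*≤S : ∀ i → sum i ≡ ℓ → S* ≤ S i
    S*≤S i refl = ∑-mono-≤ K λ {k} _ _ → m≤n+o⇒m∸n≤o _ r
      (subst ((sum i + r) /q^ k ≤_) (+-comm _ r) (sum-/-lower (q ^ k) {{m^n≢0 q k}} r i))
    v[M]≤v[M*] : ∀ {i} → i ∈ compositions (suc r) ℓ → v (multinomial ℓ i) ≤ v M*
    v[M]≤v[M*] {i} i∈ = +-cancelʳ-≤ S* _ _ (begin
      v (multinomial ℓ i) + S*    ≤⟨ +-monoʳ-≤ (v (multinomial ℓ i)) (S*≤S i Σi≡ℓ) ⟩
      v (multinomial ℓ i) + S i   ≡⟨ v-multinomial ℓ i K Σi≡ℓ ℓ≤K ⟩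
      ∑ K (λ k → ℓ /q^ k)         ≡⟨ v-multinomial ℓ i* K (sum-balanced r ℓ) ℓ≤K ⟨
      v M* + S i*                 ≡⟨ cong (v M* +_) S[i*]≡S* ⟩
      v M* + S*                   ∎)
      where
      Σi≡ℓ = ∈-compositions⁻ (suc r) ℓ i∈
    v[p]≤v[M*] : v (lcmList ms) ≤ v M*
    v[p]≤v[M*] = v[lcmList]-lub (multinomials≢0 (suc r) ℓ) (map⁺ (All.tabulate v[M]≤v[M*]))
    v[M*]≤v[p] : v M* ≤ v (lcmList ms)
    v[M*]≤v[p] = v-mono-∣ M* (lcmList ms)
      (∈⇒∣lcmList (∈-map⁺ (multinomial ℓ) (∈-compositions⁺ (suc r) ℓ i* (sum-balanced r ℓ))))

  v[p*∏]≡v[∏] : ∀ r ℓ → v (p (suc r) ℓ * ∏ r (λ j → suc (ℓ + (j ∸ 1))))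
                      ≡ v (∏ r (λ j → lcmUpTo ((ℓ + r) / suc (j ∸ 1))))
  v[p*∏]≡v[∏] r ℓ = +-cancelʳ-≡ S* _ _ (begin
    v (P * D) + S*                              ≡⟨ cong (_+ S*) (v-* P D) ⟩
    v P + v D + S*                              ≡⟨ regroup (v P) (v D) S* ⟩
    v D + (v P + S*)                            ≡⟨ cong (v D +_) (v-p r ℓ K (m≤m+n ℓ r)) ⟩
    v D + ∑ K (λ k → ℓ /q^ k)                   ≡⟨ cong (v D +_) (legendre ℓ K (m≤m+n ℓ r)) ⟨
    v D + v (ℓ !)                               ≡⟨ v-* D (ℓ !) ⟨
    v (D * ℓ !)                                 ≡⟨ cong v (∏[ℓ+j]*ℓ!≡[ℓ+r]! r ℓ) ⟩
    v (K !)                                     ≡⟨ legendre K K ≤-refl ⟩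
    ∑ K (λ k → K /q^ k)                         ≡⟨ ∑-cong K (λ {k} _ _ → m⊓n+n∸m≡n r (K /q^ k)) ⟨
    ∑ K (λ k → r ⊓ (K /q^ k) + (K /q^ k ∸ r))   ≡⟨ ∑-distrib-+ K _ _ ⟩
    ∑ K (λ k → r ⊓ (K /q^ k)) + S*              ≡⟨ cong (_+ S*) (v-∏lcmUpTo r K K ≤-refl) ⟨
    v Q + S*                                    ∎)
    where
    open ≡-Reasoning
    K = ℓ + r
    S* = ∑ K (λ k → K /q^ k ∸ r)
    P = p (suc r) ℓ
    D = ∏ r (λ j → suc (ℓ + (j ∸ 1)))
    Q = ∏ r (λ j → lcmUpTo (K / suc (j ∸ 1)))
    instance
      _ = p≢0 (suc r) ℓ
      _ = ∏≢0 r (λ j → suc (ℓ + (j ∸ 1))) (λ _ → _)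
      _ = ℓ !≢0
    regroup : ∀ a b c → a + b + c ≡ b + (a + c)
    regroup = solve-∀

module _ where
  open import Data.Nat.DivMod using (_/_)

  p*∏[ℓ+j]≡∏lcmUpTo : ∀ r ℓ → p (suc r) ℓ * ∏ r (λ j → suc (ℓ + (j ∸ 1)))
                            ≡ ∏ r (λ j → lcmUpTo ((ℓ + r) / suc (j ∸ 1)))
  p*∏[ℓ+j]≡∏lcmUpTo r ℓ =
    ≡-by-valuations _ _ λ q q-prime → ValuationIdentity.v[p*∏]≡v[∏] q q-prime r ℓ
    where
    instance
      _ = m*n≢0 (p (suc r) ℓ) _ {{p≢0 (suc r) ℓ}} {{∏≢0 r (λ j → suc (ℓ + (j ∸ 1))) (λ _ → _)}}
      _ = ∏≢0 r (λ j → lcmUpTo ((ℓ + r) / suc (j ∸ 1))) (λ j → lcmUpTo≢0 ((ℓ + r) / suc (j ∸ 1)))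

open import Data.Integer using (+_)
open import Data.Integer.Properties using (pos-*)
open import Data.Rational using (ℚ; _/_)
import Data.Rational as ℚ
open import Data.Rational.Properties using (toℚᵘ-injective; toℚᵘ-fromℚᵘ; toℚᵘ-homo-*)
open import Data.Rational.Unnormalised using (mkℚᵘ; *≡*)
open import Data.Rational.Unnormalised.Properties using (≃-trans; ≃-sym; ≃-reflexive; *-cong)
open import Defs using (prodℚ; rhs)

/-homo-* : ∀ a b c d .{{_ : NonZero b}} .{{_ : NonZero d}} →
           ((+ a) / b) ℚ.* ((+ c) / d) ≡ ((+ (a * c)) / (b * d)) {{m*n≢0 b d}}
/-homo-* a (suc b) c (suc d) = toℚᵘ-injective
  (≃-trans (toℚᵘ-homo-* ((+ a) / suc b) ((+ c) / suc d))
  (≃-trans (*-cong (toℚᵘ-fromℚᵘ (mkℚᵘ (+ a) b)) (toℚᵘ-fromℚᵘ (mkℚᵘ (+ c) d)))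
  (≃-trans (≃-reflexive (cong (λ n → mkℚᵘ n (d + b * suc d)) (sym (pos-* a c))))
           (≃-sym (toℚᵘ-fromℚᵘ (mkℚᵘ (+ (a * c)) (d + b * suc d)))))))

*≡*⇒/≡/ : ∀ a b c d .{{_ : NonZero b}} .{{_ : NonZero d}} → a * d ≡ c * b → (+ a) / b ≡ (+ c) / d
*≡*⇒/≡/ a (suc b) c (suc d) a*d≡c*b = toℚᵘ-injective
  (≃-trans (toℚᵘ-fromℚᵘ (mkℚᵘ (+ a) b))
  (≃-trans (*≡* (trans (sym (pos-* a (suc d))) (trans (cong +_ a*d≡c*b) (pos-* c (suc b)))))
           (≃-sym (toℚᵘ-fromℚᵘ (mkℚᵘ (+ c) d)))))

prodℚ-/ : ∀ K (a b : ℕ → ℕ) (b≢0 : ∀ k → NonZero (b k)) →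
          prodℚ K (λ k → ((+ a k) / b k) {{b≢0 k}}) ≡ ((+ ∏ K a) / ∏ K b) {{∏≢0 K b b≢0}}
prodℚ-/ zero    a b b≢0 = refl
prodℚ-/ (suc K) a b b≢0 = trans
  (cong (ℚ._* ((+ a (suc K)) / b (suc K)) {{b≢0 (suc K)}}) (prodℚ-/ K a b b≢0))
  (/-homo-* (∏ K a) (∏ K b) (a (suc K)) (b (suc K)) {{∏≢0 K b b≢0}} {{b≢0 (suc K)}})

theorem8p1 : (n ℓ : ℕ) → n ≥ 1 → ℓ ≥ 1 → (+ p n ℓ) / 1 ≡ rhs n ℓ
theorem8p1 (suc r) ℓ _ _ = begin
  (+ p (suc r) ℓ) / 1                  ≡⟨ *≡*⇒/≡/ (p (suc r) ℓ) 1 (∏ r num) (∏ r den) P*D≡Q*1 ⟩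
  (+ ∏ r num) / ∏ r den                ≡⟨ prodℚ-/ r num den (λ _ → _) ⟨
  rhs (suc r) ℓ                        ∎
  where
  open ≡-Reasoning
  open import Data.Nat.DivMod using () renaming (_/_ to _div_)
  num den : ℕ → ℕ
  num j = lcmUpTo ((ℓ + suc r ∸ 1) div suc (j ∸ 1))
  den j = suc (ℓ + (j ∸ 1))
  instance _ = ∏≢0 r den (λ _ → _)
  P*D≡Q*1 : p (suc r) ℓ * ∏ r den ≡ ∏ r num * 1
  P*D≡Q*1 = begin
    p (suc r) ℓ * ∏ r den    ≡⟨ p*∏[ℓ+j]≡∏lcmUpTo r ℓ ⟩
    Q (ℓ + r)                ≡⟨ cong (λ M → Q (M ∸ 1)) (+-suc ℓ r) ⟨
    Q (ℓ + suc r ∸ 1)        ≡⟨ *-identityʳ _ ⟨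
    ∏ r num * 1              ∎
    where
    Q : ℕ → ℕ
    Q M = ∏ r (λ j → lcmUpTo (M div suc (j ∸ 1)))
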